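{- Let $\mathbf{A}$ be a normal distributive nearlattice. If every dense $\alpha$-filter of $A$ contains a dense element, then $\mathbf{A}$ is quasicomplemented.
   Context: A distributive nearlattice is a join-semilattice $\langle A,\vee,1\rangle$ with greatest element $1$ in which every principal filter $[a)=\{x\in A\colon a\le x\}$ is a bounded distributive lattice. A filter of $A$ is a subset containing $1$, upward closed, and closed under those binary meets that exist. For $a\in A$, $a^{\top}=\{x\in A\colon x\vee a=1\}$ and $a^{\top\top}=\{y\in A\colon y\vee x=1\text{ for all }x\in a^{\top}\}$; for a filter $F$, $F^{\top}=\{x\in A\colon x\vee f=1\text{ for all }f\in F\}$. An element $a$ is dense if $a^{\top}=\{1\}$; a filter $F$ is dense if $F^{\top}=\{1\}$. A filter $F$ is an $\alpha$-filter if $a^{\top\top}\subseteq F$ for all $a\in F$. A prime ideal is a non-empty proper downward closed, $\vee$-closed subset $P$ with $a\wedge b\in P\Rightarrow a\in P$ or $b\in P$ whenever $a\wedge b$ exists; a maximal ideal is a non-empty proper downward closed $\vee$-closed subset not properly contained in any other proper such subset. $\mathbf{A}$ is normal if each prime ideal is contained in a unique maximal ideal; $\mathbf{A}$ is quasicomplemented if for each $a\in A$ there exists $b\in A$ with $a^{\top\top}=b^{\top}$. -}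

module Defs where

open import Level using (Level; suc; _⊔_)
open import Data.Product using (Σ; ∃; _×_; _,_)
open import Data.Sum using (_⊎_)
open import Relation.Nullary using (¬_)
open import Relation.Binary.PropositionalEquality using (_≡_)

record JoinSemilatticeTop (ℓ : Level) : Set (suc ℓ) where
  infixr 6 _∨_
  infix 4 _≤_
  field
    Carrier : Set ℓ
    _∨_     : Carrier → Carrier → Carrier
    𝟏       : Carrier
    ∨-assoc : ∀ x y z → (x ∨ y) ∨ z ≡ x ∨ (y ∨ z)
    ∨-comm  : ∀ x y → x ∨ y ≡ y ∨ x
    ∨-idem  : ∀ x → x ∨ x ≡ x
    ∨-top   : ∀ x → x ∨ 𝟏 ≡ 𝟏

  _≤_ : Carrier → Carrier → Set ℓ
  x ≤ y = x ∨ y ≡ y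

  IsMeet : Carrier → Carrier → Carrier → Set ℓ
  IsMeet x y m = m ≤ x × m ≤ y × (∀ z → z ≤ x → z ≤ y → z ≤ m)

  -- m is the meet of x and y inside the principal filter [a)
  IsMeetIn : Carrier → Carrier → Carrier → Carrier → Set ℓ
  IsMeetIn a x y m =
    a ≤ m × m ≤ x × m ≤ y × (∀ z → a ≤ z → z ≤ x → z ≤ y → z ≤ m)

-- Distributive nearlattice: every principal filter [a) is a (bounded,
-- with bottom a and top 1) distributive lattice under ∨ and its meet.
record DistributiveNearlattice (ℓ : Level) : Set (suc ℓ) where
  field
    semilattice : JoinSemilatticeTop ℓ
  open JoinSemilatticeTop semilattice public
  field
    meetIn-exists : ∀ a x y → a ≤ x → a ≤ y → Σ Carrier (IsMeetIn a x y)
    meetIn-distrib : ∀ a x y z m₁ m₂ m₃ →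
      a ≤ x → a ≤ y → a ≤ z →
      IsMeetIn a x y m₁ → IsMeetIn a x z m₂ → IsMeetIn a x (y ∨ z) m₃ →
      m₃ ≡ m₁ ∨ m₂

module _ {ℓ : Level} (A : DistributiveNearlattice ℓ) where
  open DistributiveNearlattice A

  Pred : Set (suc ℓ)
  Pred = Carrier → Set ℓ

  _⊆_ : Pred → Pred → Set ℓ
  P ⊆ Q = ∀ x → P x → Q x

  _≐_ : Pred → Pred → Set ℓ
  P ≐ Q = P ⊆ Q × Q ⊆ P

  IsFilter : Pred → Set ℓ
  IsFilter F = F 𝟏
    × (∀ x y → x ≤ y → F x → F y)
    × (∀ x y m → IsMeet x y m → F x → F y → F m)

  ⊤of : Carrier → Pred
  ⊤of a x = x ∨ a ≡ 𝟏

  ⊤⊤of : Carrier → Pred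
  ⊤⊤of a y = ∀ x → ⊤of a x → y ∨ x ≡ 𝟏

  ⊤ofFilter : Pred → Pred
  ⊤ofFilter F x = ∀ f → F f → x ∨ f ≡ 𝟏

  IsDenseElement : Carrier → Set ℓ
  IsDenseElement a = ∀ x → ⊤of a x → x ≡ 𝟏

  IsDenseFilter : Pred → Set ℓ
  IsDenseFilter F = ∀ x → ⊤ofFilter F x → x ≡ 𝟏

  IsαFilter : Pred → Set ℓ
  IsαFilter F = IsFilter F × (∀ a → F a → ⊤⊤of a ⊆ F)

  IsIdeal : Pred → Set ℓ
  IsIdeal P = (∃ λ x → P x)
    × (∃ λ x → ¬ P x)
    × (∀ x y → x ≤ y → P y → P x)
    × (∀ x y → P x → P y → P (x ∨ y))

  IsPrimeIdeal : Pred → Set ℓ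
  IsPrimeIdeal P = IsIdeal P
    × (∀ a b m → IsMeet a b m → P m → P a ⊎ P b)

  IsMaximalIdeal : Pred → Set (suc ℓ)
  IsMaximalIdeal M = IsIdeal M × (∀ Q → IsIdeal Q → M ⊆ Q → Q ⊆ M)

  IsNormal : Set (suc ℓ)
  IsNormal = ∀ P → IsPrimeIdeal P →
    Σ Pred λ M → IsMaximalIdeal M × P ⊆ M
      × (∀ M′ → IsMaximalIdeal M′ → P ⊆ M′ → M′ ≐ M)

  IsQuasicomplemented : Set ℓ
  IsQuasicomplemented = ∀ a → Σ Carrier λ b → ⊤⊤of a ≐ ⊤of b

-- For fixed a, let x ∈ ⊤∨⊤⊤ a when some b ∈ a^⊤ puts w ∨ c in x^⊤ for all
-- w ∈ b^⊤ and c ∈ a^⊤: a meet-free stand-in for the filter generated by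
-- a^⊤ ∪ a^⊤⊤, since the meets b ∧ c need not exist.  It contains a^⊤ and a^⊤⊤,
-- hence is dense, and it is an α-filter; closure under meets is where
-- distributivity of the principal filters enters.  If a dense element d lies in
-- it with witness b, then every such w ∨ c is 1, i.e. b^⊤ ⊆ a^⊤⊤, while b ∈ a^⊤
-- gives a^⊤⊤ ⊆ b^⊤: b is a quasicomplement of a.
module Submission where

open import Defs
open import Level using (Level)
open import Data.Product using (Σ; _×_; _,_)
open import Relation.Binary.PropositionalEquality
  using (_≡_; refl; sym; trans; cong; subst; module ≡-Reasoning)

module NearlatticeProperties {ℓ : Level} (A : DistributiveNearlattice ℓ) where
  open DistributiveNearlattice A

  ≤-refl : ∀ x → x ≤ x
  ≤-refl = ∨-idem

  ≤-trans : ∀ {x y z} → x ≤ y → y ≤ z → x ≤ z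
  ≤-trans {x} {y} {z} x≤y y≤z = begin
    x ∨ z        ≡⟨ cong (x ∨_) (sym y≤z) ⟩
    x ∨ (y ∨ z)  ≡⟨ sym (∨-assoc x y z) ⟩
    (x ∨ y) ∨ z  ≡⟨ cong (_∨ z) x≤y ⟩
    y ∨ z        ≡⟨ y≤z ⟩
    z            ∎
    where open ≡-Reasoning

  x≤x∨y : ∀ x y → x ≤ x ∨ y
  x≤x∨y x y = trans (sym (∨-assoc x x y)) (cong (_∨ y) (∨-idem x))

  y≤x∨y : ∀ x y → y ≤ x ∨ y
  y≤x∨y x y = subst (y ≤_) (∨-comm y x) (x≤x∨y y x)

  ∨-least : ∀ {x y z} → x ≤ z → y ≤ z → x ∨ y ≤ z
  ∨-least {x} {y} {z} x≤z y≤z = trans (∨-assoc x y z) (trans (cong (x ∨_) y≤z) x≤z)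

  ∨-mono : ∀ {x x′ y y′} → x ≤ x′ → y ≤ y′ → x ∨ y ≤ x′ ∨ y′
  ∨-mono {x′ = x′} {y′ = y′} x≤x′ y≤y′ =
    ∨-least (≤-trans x≤x′ (x≤x∨y x′ y′)) (≤-trans y≤y′ (y≤x∨y x′ y′))

  𝟏∨x≡𝟏 : ∀ x → 𝟏 ∨ x ≡ 𝟏
  𝟏∨x≡𝟏 x = trans (∨-comm 𝟏 x) (∨-top x)

  ≡𝟏-upward : ∀ {x y} → x ≤ y → x ≡ 𝟏 → y ≡ 𝟏
  ≡𝟏-upward {y = y} x≤y refl = trans (sym x≤y) (𝟏∨x≡𝟏 y)

  ∨≡𝟏-monoˡ : ∀ {x x′ y} → x ≤ x′ → x ∨ y ≡ 𝟏 → x′ ∨ y ≡ 𝟏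
  ∨≡𝟏-monoˡ {y = y} x≤x′ = ≡𝟏-upward (∨-mono x≤x′ (≤-refl y))

  ∨≡𝟏-monoʳ : ∀ {x y y′} → y ≤ y′ → x ∨ y ≡ 𝟏 → x ∨ y′ ≡ 𝟏
  ∨≡𝟏-monoʳ {x} y≤y′ = ≡𝟏-upward (∨-mono (≤-refl x) y≤y′)

  IsMeet⇒IsMeetIn : ∀ {x y m} → IsMeet x y m → IsMeetIn m x y m
  IsMeet⇒IsMeetIn {m = m} (m≤x , m≤y , greatest) =
    ≤-refl m , m≤x , m≤y , λ z _ → greatest z

  IsMeetIn-comm : ∀ {e x y m} → IsMeetIn e x y m → IsMeetIn e y x m
  IsMeetIn-comm (e≤m , m≤x , m≤y , greatest) =
    e≤m , m≤y , m≤x , λ z e≤z z≤y z≤x → greatest z e≤z z≤x z≤y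

  IsMeetIn-𝟏 : ∀ {e y} → e ≤ y → IsMeetIn e y 𝟏 y
  IsMeetIn-𝟏 {y = y} e≤y = e≤y , ≤-refl y , ∨-top y , λ z _ z≤y _ → z≤y

  -- In the distributive lattice [e): y = y ∧ (x ∨ t) = (y ∧ x) ∨ (y ∧ t) ≤ t.
  ≤-of-meetIn : ∀ {e x y m t} → IsMeetIn e x y m →
    e ≤ t → x ∨ t ≡ 𝟏 → m ≤ t → y ≤ t
  ≤-of-meetIn {e} {x} {y} {m} {t} x∧y≡m@(e≤m , m≤x , m≤y , _) e≤t x∨t≡𝟏 m≤t
    with meetIn-exists e y t (≤-trans e≤m m≤y) e≤t
  ... | q , y∧t≡q@(_ , _ , q≤t , _) = subst (_≤ t) (sym y≡m∨q) (∨-least m≤t q≤t)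
    where
    e≤y : e ≤ y
    e≤y = ≤-trans e≤m m≤y

    y∧[x∨t]≡y : IsMeetIn e y (x ∨ t) y
    y∧[x∨t]≡y = subst (λ u → IsMeetIn e y u y) (sym x∨t≡𝟏) (IsMeetIn-𝟏 e≤y)

    y≡m∨q : y ≡ m ∨ q
    y≡m∨q = meetIn-distrib e y x t m q y e≤y (≤-trans e≤m m≤x) e≤t
      (IsMeetIn-comm x∧y≡m) y∧t≡q y∧[x∨t]≡y

  ⊤of-meetIn : ∀ {e x y m s} → IsMeetIn e x y m →
    ⊤of A s x → ⊤of A s y → ⊤of A s m
  ⊤of-meetIn {y = y} {m} {s} x∧y≡m@(e≤m , _) x∨s≡𝟏 y∨s≡𝟏 =
    ≡𝟏-upward (∨-least y≤m∨s (y≤x∨y m s)) y∨s≡𝟏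
    where
    y≤m∨s : y ≤ m ∨ s
    y≤m∨s = ≤-of-meetIn x∧y≡m (≤-trans e≤m (x≤x∨y m s))
      (∨≡𝟏-monoʳ (y≤x∨y m s) x∨s≡𝟏) (x≤x∨y m s)

  ⊤of-sym : ∀ {x y} → ⊤of A x y → ⊤of A y x
  ⊤of-sym {x} {y} = trans (∨-comm x y)

  ⊤⊤of-⊆-⊤of : ∀ {a b} → ⊤of A a b → ∀ y → ⊤⊤of A a y → ⊤of A b y
  ⊤⊤of-⊆-⊤of {b = b} b∨a≡𝟏 y y∈a⊤⊤ = y∈a⊤⊤ b b∨a≡𝟏

  ⊤ofFilter-⊆-⊤⊤of : ∀ {a F} → (∀ c → ⊤of A a c → F c) →
    ∀ z → ⊤ofFilter A F z → ⊤⊤of A a z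
  ⊤ofFilter-⊆-⊤⊤of a⊤⊆F z z∈F⊤ c c∈a⊤ = z∈F⊤ c (a⊤⊆F c c∈a⊤)

  dense-if-⊇⊤of∪⊤⊤of : ∀ {a F} → (∀ c → ⊤of A a c → F c) →
    (∀ y → ⊤⊤of A a y → F y) → IsDenseFilter A F
  dense-if-⊇⊤of∪⊤⊤of a⊤⊆F a⊤⊤⊆F z z∈F⊤ =
    trans (sym (∨-idem z)) (z∈F⊤ z (a⊤⊤⊆F z (⊤ofFilter-⊆-⊤⊤of a⊤⊆F z z∈F⊤)))

  ⊤∨⊤⊤Witness : Carrier → Carrier → Carrier → Set ℓ
  ⊤∨⊤⊤Witness a x b =
    ⊤of A a b × (∀ w c → ⊤of A b w → ⊤of A a c → ⊤of A x (w ∨ c))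

  ⊤∨⊤⊤ : Carrier → Pred A
  ⊤∨⊤⊤ a x = Σ Carrier (⊤∨⊤⊤Witness a x)

  ⊤of⊆⊤∨⊤⊤ : ∀ {a} c → ⊤of A a c → ⊤∨⊤⊤ a c
  ⊤of⊆⊤∨⊤⊤ c c∈a⊤ = c , c∈a⊤ , λ w c′ w∨c≡𝟏 _ → ∨≡𝟏-monoˡ (x≤x∨y w c′) w∨c≡𝟏

  ⊤⊤of⊆⊤∨⊤⊤ : ∀ {a} y → ⊤⊤of A a y → ⊤∨⊤⊤ a y
  ⊤⊤of⊆⊤∨⊤⊤ {a} y y∈a⊤⊤ = 𝟏 , 𝟏∨x≡𝟏 a , λ w c _ c∈a⊤ →
    ∨≡𝟏-monoˡ (y≤x∨y w c) (⊤of-sym (y∈a⊤⊤ c c∈a⊤))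

  ⊤∨⊤⊤-upward : ∀ {a} x y → x ≤ y → ⊤∨⊤⊤ a x → ⊤∨⊤⊤ a y
  ⊤∨⊤⊤-upward x y x≤y (b , b∈a⊤ , sep) =
    b , b∈a⊤ , λ w c w∈b⊤ c∈a⊤ → ∨≡𝟏-monoʳ x≤y (sep w c w∈b⊤ c∈a⊤)

  ⊤∨⊤⊤-⊤⊤of-closed : ∀ {a} x → ⊤∨⊤⊤ a x → ∀ y → ⊤⊤of A x y → ⊤∨⊤⊤ a y
  ⊤∨⊤⊤-⊤⊤of-closed x (b , b∈a⊤ , sep) y y∈x⊤⊤ =
    b , b∈a⊤ , λ w c w∈b⊤ c∈a⊤ → ⊤of-sym (y∈x⊤⊤ (w ∨ c) (sep w c w∈b⊤ c∈a⊤))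

  -- Apply the witness condition to w ∨ x ∈ b^⊤ and absorb the extra x.
  ⊤∨⊤⊤Witness-∨ : ∀ {a x b} → ⊤∨⊤⊤Witness a x b →
    ∀ w c → ⊤of A (b ∨ x) w → ⊤of A a c → ⊤of A x (w ∨ c)
  ⊤∨⊤⊤Witness-∨ {x = x} {b} (_ , sep) w c w∈[b∨x]⊤ c∈a⊤ =
    ≡𝟏-upward ≤[w∨c]∨x (sep (w ∨ x) c w∨x∈b⊤ c∈a⊤)
    where
    w∨x∈b⊤ : ⊤of A b (w ∨ x)
    w∨x∈b⊤ = trans (∨-assoc w x b) (trans (cong (w ∨_) (∨-comm x b)) w∈[b∨x]⊤)

    ≤[w∨c]∨x : ((w ∨ x) ∨ c) ∨ x ≤ (w ∨ c) ∨ x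
    ≤[w∨c]∨x = ∨-least
      (∨-least (∨-mono (x≤x∨y w c) (≤-refl x)) (≤-trans (y≤x∨y w c) (x≤x∨y (w ∨ c) x)))
      (y≤x∨y (w ∨ c) x)

  ⊤∨⊤⊤-meet : ∀ {a} x y m → IsMeet x y m → ⊤∨⊤⊤ a x → ⊤∨⊤⊤ a y → ⊤∨⊤⊤ a m
  ⊤∨⊤⊤-meet {a} x y m x∧y≡m@(m≤x , m≤y , _)
    (b₁ , wit₁@(b₁∈a⊤ , _)) (b₂ , wit₂@(b₂∈a⊤ , _))
    with meetIn-exists m (b₁ ∨ x) (b₂ ∨ y)
           (≤-trans m≤x (y≤x∨y b₁ x)) (≤-trans m≤y (y≤x∨y b₂ y))
  ... | b , B₁∧B₂≡b@(_ , b≤B₁ , b≤B₂ , _) = b , b∈a⊤ , sep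
    where
    b∈a⊤ : ⊤of A a b
    b∈a⊤ = ⊤of-meetIn B₁∧B₂≡b
      (∨≡𝟏-monoˡ (x≤x∨y b₁ x) b₁∈a⊤) (∨≡𝟏-monoˡ (x≤x∨y b₂ y) b₂∈a⊤)

    sep : ∀ w c → ⊤of A b w → ⊤of A a c → ⊤of A m (w ∨ c)
    sep w c w∈b⊤ c∈a⊤ = ⊤of-sym (⊤of-meetIn (IsMeet⇒IsMeetIn x∧y≡m)
      (⊤of-sym (⊤∨⊤⊤Witness-∨ wit₁ w c (∨≡𝟏-monoʳ b≤B₁ w∈b⊤) c∈a⊤))
      (⊤of-sym (⊤∨⊤⊤Witness-∨ wit₂ w c (∨≡𝟏-monoʳ b≤B₂ w∈b⊤) c∈a⊤)))

  ⊤∨⊤⊤-isαFilter : ∀ a → IsαFilter A (⊤∨⊤⊤ a)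
  ⊤∨⊤⊤-isαFilter a =
    (⊤⊤of⊆⊤∨⊤⊤ 𝟏 (λ x _ → 𝟏∨x≡𝟏 x) , ⊤∨⊤⊤-upward , ⊤∨⊤⊤-meet) , ⊤∨⊤⊤-⊤⊤of-closed

  ⊤∨⊤⊤-isDense : ∀ a → IsDenseFilter A (⊤∨⊤⊤ a)
  ⊤∨⊤⊤-isDense a = dense-if-⊇⊤of∪⊤⊤of ⊤of⊆⊤∨⊤⊤ ⊤⊤of⊆⊤∨⊤⊤

  quasicomplement-from-dense-member : ∀ {a d} → IsDenseElement A d → ⊤∨⊤⊤ a d →
    Σ Carrier λ b → _≐_ A (⊤⊤of A a) (⊤of A b)
  quasicomplement-from-dense-member d-dense (b , b∈a⊤ , sep) =
    b , ⊤⊤of-⊆-⊤of b∈a⊤ , λ w w∈b⊤ c c∈a⊤ → d-dense (w ∨ c) (sep w c w∈b⊤ c∈a⊤)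

theorem3p12 : {ℓ : Level} (A : DistributiveNearlattice ℓ) →
    IsNormal A →
    (∀ F → IsαFilter A F → IsDenseFilter A F →
      Σ (DistributiveNearlattice.Carrier A) λ d → F d × IsDenseElement A d) →
    IsQuasicomplemented A
theorem3p12 A _ dense-αFilter-has-dense-element a =
  let d , d∈F , d-dense = dense-αFilter-has-dense-element
        (⊤∨⊤⊤ a) (⊤∨⊤⊤-isαFilter a) (⊤∨⊤⊤-isDense a)
  in quasicomplement-from-dense-member d-dense d∈F
  where open NearlatticeProperties A
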